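{- Let $F\colon\mathbb{F}_2^n\to\mathbb{F}_2^n$ be an APN function. Let $U$ be an $(n-2)$-dimensional linear subspace of $\mathbb{F}_2^n$ and let $U_1=U+u_1$, $U_2=U+u_2$, $U_3=U+u_3$, $U_4=U+u_4$ be the four cosets of $U$, with $u_1=0$ and $u_2,u_3,u_4\in\mathbb{F}_2^n$, so that $\mathbb{F}_2^n=U_1\cup U_2\cup U_3\cup U_4$. Let $a_1,a_2,a_3,a_4\in\mathbb{F}_2^n$ and define $G\colon\mathbb{F}_2^n\to\mathbb{F}_2^n$ by $G(x)=F(x)+a_i$ for $x\in U_i$, $i=1,2,3,4$. Then $G$ is APN if and only if $$F(x_1)+F(x_2)+F(x_3)+F(x_4)\neq a_1+a_2+a_3+a_4$$ for every $2$-dimensional affine subspace $\{x_1,x_2,x_3,x_4\}$ of $\mathbb{F}_2^n$ satisfying $|\{x_1,x_2,x_3,x_4\}\cap U_i|=1$ for all $i=1,2,3,4$.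
   Context: A function $F\colon\mathbb{F}_2^n\to\mathbb{F}_2^n$ is APN if for every nonzero $a$ and every $b$ the set $\{x: F(x+a)+F(x)=b\}$ has at most $2$ elements. A set $\{x_1,x_2,x_3,x_4\}\subseteq\mathbb{F}_2^n$ is a $2$-dimensional affine subspace if $x_1,\dots,x_4$ are pairwise distinct and $x_1+x_2+x_3+x_4=0$. -}

module Defs where

open import Data.Nat using (ℕ; _∸_)
open import Data.Bool using (Bool; true; false; _xor_; _∧_)
open import Data.Fin using (Fin)
open import Data.Vec using (Vec; replicate; zipWith; foldr; _∷_; [])
open import Data.Product using (Σ; ∃; _×_; _,_)
open import Relation.Binary.PropositionalEquality using (_≡_; _≢_)
open import Relation.Nullary using (¬_)

V : ℕ → Set
V n = Vec Bool n

infixl 6 _⊕_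
_⊕_ : ∀ {n} → V n → V n → V n
_⊕_ = zipWith _xor_

𝟎 : ∀ {n} → V n
𝟎 = replicate _ false

_·_ : ∀ {n} → Bool → V n → V n
c · v = Data.Vec.map (c ∧_) v

lincomb : ∀ {n k} → Vec Bool k → Vec (V n) k → V n
lincomb [] [] = 𝟎
lincomb (c ∷ cs) (b ∷ bs) = (c · b) ⊕ lincomb cs bs

LinIndep : ∀ {n k} → Vec (V n) k → Set
LinIndep {k = k} bs = ∀ (cs : Vec Bool k) → lincomb cs bs ≡ 𝟎 → cs ≡ replicate k false

_∈Span_ : ∀ {n k} → V n → Vec (V n) k → Set
_∈Span_ {k = k} x bs = Σ (Vec Bool k) λ cs → lincomb cs bs ≡ x

-- F : 𝔽₂ⁿ → 𝔽₂ⁿ is APN: for every a ≠ 0 and every b, the equation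
-- F(x+a)+F(x)=b has at most 2 solutions, i.e. among any three pairwise
-- distinct elements at most two are solutions.
IsSolution : ∀ {n} → (V n → V n) → V n → V n → V n → Set
IsSolution F a b x = F (x ⊕ a) ⊕ F x ≡ b

APN : ∀ {n} → (V n → V n) → Set
APN {n} F = ∀ (a b : V n) → a ≢ 𝟎 →
  ∀ (x y z : V n) → x ≢ y → x ≢ z → y ≢ z →
  ¬ (IsSolution F a b x × IsSolution F a b y × IsSolution F a b z)

-- {x₁,x₂,x₃,x₄} is a 2-dimensional affine subspace:
-- pairwise distinct and x₁+x₂+x₃+x₄ = 0.
Affine2 : ∀ {n} → V n → V n → V n → V n → Set
Affine2 x₁ x₂ x₃ x₄ =
  x₁ ≢ x₂ × x₁ ≢ x₃ × x₁ ≢ x₄ × x₂ ≢ x₃ × x₂ ≢ x₄ × x₃ ≢ x₄ ×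
  x₁ ⊕ x₂ ⊕ x₃ ⊕ x₄ ≡ 𝟎

ExactlyOne : (Fin 4 → Set) → Set
ExactlyOne P = Σ (Fin 4) λ j → P j × (∀ k → P k → k ≡ j)

{-# OPTIONS --safe #-}
-- A function H is APN iff H has nonzero sum on every 2-flat. Writing G = F ⊕ a ∘ c,
-- where c x is the index of the coset of U containing x, the sum of G over a flat is the sum of
-- F plus the sum of a ∘ c. Either the flat meets every coset exactly once, and then the latter
-- sum is a₁ ⊕ a₂ ⊕ a₃ ⊕ a₄; or two of its points lie in a common coset, and then so do the other
-- two (their sum is the same element of U), so the latter sum vanishes and APN-ness of F applies.
module Submission where

open import Defs
open import Algebra.Bundles using (AbelianGroup)
import Algebra.Properties.CommutativeMonoid.Sum as CommutativeMonoidSum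
import Algebra.Properties.CommutativeSemigroup as CommutativeSemigroupProperties
import Algebra.Properties.Group as GroupProperties
open import Data.Bool as Bool using (Bool; _xor_)
open import Data.Bool.Properties using (xor-assoc; xor-comm; xor-same; xor-identityˡ; xor-identityʳ; ∧-distribʳ-xor)
open import Data.Empty using (⊥)
open import Data.Fin using (Fin; zero; suc; _<_; punchOut)
open import Data.Fin.Patterns using (0F; 1F; 2F; 3F)
open import Data.Fin.Permutation using (permutation)
open import Data.Fin.Properties using (_≟_; _<?_; <-cmp; any?; punchOut-injective; injective⇒≤)
open import Data.Nat using (ℕ; suc; _∸_; s≤s)
open import Data.Nat.Properties using (1+n≰n)
open import Data.Product using (Σ; ∃₂; _×_; _,_; proj₁; proj₂)
open import Data.Sum using (_⊎_; inj₁; inj₂)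
open import Data.Vec using (Vec; _∷_; []; lookup)
open import Data.Vec.Properties using (zipWith-assoc; zipWith-comm; zipWith-identityˡ; zipWith-identityʳ; zipWith-inverseˡ; map-id; ≡-dec)
open import Function using (_∘_; id; case_of_)
open import Function.Bundles using (_⇔_; mk⇔)
open import Function.Definitions using (Injective; StrictlySurjective)
open import Relation.Binary.Definitions using (tri<; tri≈; tri>)
open import Relation.Binary.PropositionalEquality
  using (_≡_; _≢_; refl; sym; trans; cong; cong₂; subst; isEquivalence; module ≡-Reasoning)
open import Relation.Nullary using (¬_; yes; no; contradiction)
open import Relation.Nullary.Decidable using (_×-dec_)

open ≡-Reasoning

⊕-self : ∀ {n} (x : V n) → x ⊕ x ≡ 𝟎
⊕-self x = trans (cong (_⊕ x) (sym (map-id x))) (zipWith-inverseˡ xor-same x)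

⊕-abelianGroup : ℕ → AbelianGroup _ _
⊕-abelianGroup n = record
  { Carrier = V n
  ; _≈_ = _≡_
  ; _∙_ = _⊕_
  ; ε = 𝟎
  ; _⁻¹ = id
  ; isAbelianGroup = record
    { isGroup = record
      { isMonoid = record
        { isSemigroup = record
          { isMagma = record { isEquivalence = isEquivalence ; ∙-cong = cong₂ _⊕_ }
          ; assoc = zipWith-assoc xor-assoc
          }
        ; identity = zipWith-identityˡ xor-identityˡ , zipWith-identityʳ xor-identityʳ
        }
      ; inverse = ⊕-self , ⊕-self
      ; ⁻¹-cong = cong id
      }
    ; comm = zipWith-comm xor-comm
    }
  }

module _ {n : ℕ} where
  open AbelianGroup (⊕-abelianGroup n) public
    using () renaming (assoc to ⊕-assoc; comm to ⊕-comm; identityʳ to ⊕-identityʳ)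
  open GroupProperties (AbelianGroup.group (⊕-abelianGroup n)) public
    using (inverseˡ-unique)
    renaming (∙-cancelˡ to ⊕-cancelˡ; ∙-cancelʳ to ⊕-cancelʳ; \\-leftDividesˡ to x⊕[x⊕y]≡y; //-rightDividesʳ to y⊕x⊕x≡y)
  open CommutativeSemigroupProperties (AbelianGroup.commutativeSemigroup (⊕-abelianGroup n)) public
    using () renaming (interchange to ⊕-interchange)
  open CommutativeMonoidSum (AbelianGroup.commutativeMonoid (⊕-abelianGroup n)) public
    using (sum; sum-permute; ∑-distrib-+)

⊕≡𝟎⇒≡ : ∀ {n} {x y : V n} → x ⊕ y ≡ 𝟎 → x ≡ y
⊕≡𝟎⇒≡ = inverseˡ-unique _ _

Σ₄ : ∀ {n} → (Fin 4 → V n) → V n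
Σ₄ y = y 0F ⊕ y 1F ⊕ y 2F ⊕ y 3F

Σ₄≡sum : ∀ {n} (y : Fin 4 → V n) → Σ₄ y ≡ sum y
Σ₄≡sum y = begin
  y 0F ⊕ y 1F ⊕ y 2F ⊕ y 3F           ≡⟨ ⊕-assoc (y 0F ⊕ y 1F) (y 2F) (y 3F) ⟩
  y 0F ⊕ y 1F ⊕ (y 2F ⊕ y 3F)         ≡⟨ ⊕-assoc (y 0F) (y 1F) (y 2F ⊕ y 3F) ⟩
  y 0F ⊕ (y 1F ⊕ (y 2F ⊕ y 3F))       ≡⟨ cong (λ w → y 0F ⊕ (y 1F ⊕ (y 2F ⊕ w))) (⊕-identityʳ (y 3F)) ⟨
  y 0F ⊕ (y 1F ⊕ (y 2F ⊕ (y 3F ⊕ 𝟎))) ∎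

Σ₄-cong : ∀ {n} {y z : Fin 4 → V n} → (∀ j → y j ≡ z j) → Σ₄ y ≡ Σ₄ z
Σ₄-cong y≗z = cong₂ _⊕_ (cong₂ _⊕_ (cong₂ _⊕_ (y≗z 0F) (y≗z 1F)) (y≗z 2F)) (y≗z 3F)

Σ₄-⊕ : ∀ {n} (y z : Fin 4 → V n) → Σ₄ (λ j → y j ⊕ z j) ≡ Σ₄ y ⊕ Σ₄ z
Σ₄-⊕ y z = begin
  Σ₄ (λ j → y j ⊕ z j)     ≡⟨ Σ₄≡sum (λ j → y j ⊕ z j) ⟩
  sum (λ j → y j ⊕ z j)    ≡⟨ ∑-distrib-+ y z ⟩
  sum y ⊕ sum z            ≡⟨ cong₂ _⊕_ (Σ₄≡sum y) (Σ₄≡sum z) ⟨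
  Σ₄ y ⊕ Σ₄ z              ∎

Σ₄-split₀₁ : ∀ {n} (y : Fin 4 → V n) → Σ₄ y ≡ (y 0F ⊕ y 1F) ⊕ (y 2F ⊕ y 3F)
Σ₄-split₀₁ y = ⊕-assoc (y 0F ⊕ y 1F) (y 2F) (y 3F)

Σ₄-split₀₂ : ∀ {n} (y : Fin 4 → V n) → Σ₄ y ≡ (y 0F ⊕ y 2F) ⊕ (y 1F ⊕ y 3F)
Σ₄-split₀₂ y = trans (Σ₄-split₀₁ y) (⊕-interchange (y 0F) (y 1F) (y 2F) (y 3F))

Σ₄-split₀₃ : ∀ {n} (y : Fin 4 → V n) → Σ₄ y ≡ (y 0F ⊕ y 3F) ⊕ (y 1F ⊕ y 2F)
Σ₄-split₀₃ y = begin
  Σ₄ y                              ≡⟨ Σ₄-split₀₁ y ⟩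
  (y 0F ⊕ y 1F) ⊕ (y 2F ⊕ y 3F)     ≡⟨ cong (y 0F ⊕ y 1F ⊕_) (⊕-comm (y 2F) (y 3F)) ⟩
  (y 0F ⊕ y 1F) ⊕ (y 3F ⊕ y 2F)     ≡⟨ ⊕-interchange (y 0F) (y 1F) (y 3F) (y 2F) ⟩
  (y 0F ⊕ y 3F) ⊕ (y 1F ⊕ y 2F)     ∎

Σ₄-split : ∀ {j k : Fin 4} → j < k →
  ∃₂ λ l m → ∀ {n} (y : Fin 4 → V n) → Σ₄ y ≡ (y j ⊕ y k) ⊕ (y l ⊕ y m)
Σ₄-split {0F} {1F} _ = 2F , 3F , Σ₄-split₀₁
Σ₄-split {0F} {2F} _ = 1F , 3F , Σ₄-split₀₂
Σ₄-split {0F} {3F} _ = 1F , 2F , Σ₄-split₀₃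
Σ₄-split {1F} {2F} _ = 0F , 3F , λ y → trans (Σ₄-split₀₃ y) (⊕-comm _ _)
Σ₄-split {1F} {3F} _ = 0F , 2F , λ y → trans (Σ₄-split₀₂ y) (⊕-comm _ _)
Σ₄-split {2F} {3F} _ = 0F , 1F , λ y → trans (Σ₄-split₀₁ y) (⊕-comm _ _)
Σ₄-split {_} {0F} ()
Σ₄-split {suc _} {1F} (s≤s ())
Σ₄-split {suc (suc _)} {2F} (s≤s (s≤s ()))
Σ₄-split {3F} {3F} (s≤s (s≤s (s≤s ())))

injective⇒strictlySurjective : ∀ {n} {σ : Fin n → Fin n} → Injective _≡_ _≡_ σ → StrictlySurjective _≡_ σ
injective⇒strictlySurjective {suc n} {σ} σ-injective i with any? (λ j → σ j ≟ i)
... | yes hit = hit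
... | no  miss = contradiction (injective⇒≤ punched-injective) 1+n≰n
  where
  i∉image : ∀ j → i ≢ σ j
  i∉image j i≡σj = miss (j , sym i≡σj)

  punched-injective : Injective _≡_ _≡_ (λ j → punchOut (i∉image j))
  punched-injective = σ-injective ∘ punchOut-injective (i∉image _) (i∉image _)

injective-or-collision : ∀ {m n} (σ : Fin m → Fin n) →
  Injective _≡_ _≡_ σ ⊎ ∃₂ λ j k → j < k × σ j ≡ σ k
injective-or-collision σ with any? (λ j → any? (λ k → j <? k ×-dec σ j ≟ σ k))
... | yes (j , k , collision) = inj₂ (j , k , collision)
... | no  no-collision = inj₁ injective
  where
  injective : Injective _≡_ _≡_ σ
  injective {j} {k} σj≡σk with <-cmp j k
  ... | tri< j<k _ _ = contradiction (j , k , j<k , σj≡σk) no-collision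
  ... | tri≈ _ j≡k _ = j≡k
  ... | tri> _ _ k<j = contradiction (k , j , k<j , sym σj≡σk) no-collision

sum-∘-injective : ∀ {m n} (y : Fin m → V n) {σ : Fin m → Fin m} → Injective _≡_ _≡_ σ →
  sum (y ∘ σ) ≡ sum y
sum-∘-injective y {σ} σ-injective = sym (sum-permute y (permutation σ σ⁻¹ σ∘σ⁻¹ σ⁻¹∘σ))
  where
  σ-surjective = injective⇒strictlySurjective σ-injective
  σ⁻¹ = proj₁ ∘ σ-surjective
  σ∘σ⁻¹ = proj₂ ∘ σ-surjective
  σ⁻¹∘σ = λ j → σ-injective (σ∘σ⁻¹ (σ j))

Σ₄-∘-injective : ∀ {n} (y : Fin 4 → V n) {σ : Fin 4 → Fin 4} → Injective _≡_ _≡_ σ →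
  Σ₄ (y ∘ σ) ≡ Σ₄ y
Σ₄-∘-injective y {σ} σ-injective = begin
  Σ₄ (y ∘ σ)   ≡⟨ Σ₄≡sum (y ∘ σ) ⟩
  sum (y ∘ σ)  ≡⟨ sum-∘-injective y σ-injective ⟩
  sum y        ≡⟨ Σ₄≡sum y ⟨
  Σ₄ y         ∎

sum≡𝟎⇒pairs : ∀ {n} {w x y z : V n} → w ⊕ x ⊕ y ⊕ z ≡ 𝟎 → w ⊕ x ≡ y ⊕ z
sum≡𝟎⇒pairs sum≡𝟎 = ⊕≡𝟎⇒≡ (trans (sym (⊕-assoc _ _ _)) sum≡𝟎)

pairs⇒sum≡𝟎 : ∀ {n} {w x y z : V n} → w ⊕ x ≡ y ⊕ z → w ⊕ x ⊕ y ⊕ z ≡ 𝟎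
pairs⇒sum≡𝟎 {y = y} {z} pairs = trans (⊕-assoc _ _ _) (trans (cong (_⊕ (y ⊕ z)) pairs) (⊕-self (y ⊕ z)))

IsFlat : ∀ {n} → (Fin 4 → V n) → Set
IsFlat x = Affine2 (x 0F) (x 1F) (x 2F) (x 3F)

flat⇒Σ₄≡𝟎 : ∀ {n} {x : Fin 4 → V n} → IsFlat x → Σ₄ x ≡ 𝟎
flat⇒Σ₄≡𝟎 (_ , _ , _ , _ , _ , _ , x-sum≡𝟎) = x-sum≡𝟎

translates-flat : ∀ {n} {a x y : V n} → a ≢ 𝟎 → x ≢ y → y ≢ x ⊕ a → Affine2 x (x ⊕ a) y (y ⊕ a)
translates-flat {a = a} {x} {y} a≢𝟎 x≢y y≢x⊕a =
  x≢x⊕a x , x≢y , x≢y⊕a , y≢x⊕a ∘ sym , x≢y ∘ ⊕-cancelʳ a x y , x≢x⊕a y ,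
  pairs⇒sum≡𝟎 (trans (x⊕[x⊕y]≡y x a) (sym (x⊕[x⊕y]≡y y a)))
  where
  x≢x⊕a : ∀ x → x ≢ x ⊕ a
  x≢x⊕a x x≡x⊕a = a≢𝟎 (sym (⊕-cancelˡ x 𝟎 a (trans (⊕-identityʳ x) x≡x⊕a)))

  x≢y⊕a : x ≢ y ⊕ a
  x≢y⊕a x≡y⊕a = y≢x⊕a (sym (trans (cong (_⊕ a) x≡y⊕a) (y⊕x⊕x≡y a y)))

APN⇒flat-sum≢𝟎 : ∀ {n} {H : V n → V n} → APN H → ∀ x → IsFlat x → Σ₄ (H ∘ x) ≢ 𝟎
APN⇒flat-sum≢𝟎 {H = H} apn x (x₀≢x₁ , x₀≢x₂ , _ , x₁≢x₂ , _ , _ , x-sum≡𝟎) H-sum≡𝟎 =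
  apn (x₀ ⊕ x₁) (H x₀ ⊕ H x₁) (x₀≢x₁ ∘ ⊕≡𝟎⇒≡) x₀ x₁ x₂ x₀≢x₁ x₀≢x₂ x₁≢x₂
    (x₀-solution , x₁-solution , x₂-solution)
  where
  x₀ = x 0F
  x₁ = x 1F
  x₂ = x 2F
  x₃ = x 3F

  x₀-solution : H (x₀ ⊕ (x₀ ⊕ x₁)) ⊕ H x₀ ≡ H x₀ ⊕ H x₁
  x₀-solution = begin
    H (x₀ ⊕ (x₀ ⊕ x₁)) ⊕ H x₀  ≡⟨ cong (λ w → H w ⊕ H x₀) (x⊕[x⊕y]≡y x₀ x₁) ⟩
    H x₁ ⊕ H x₀                ≡⟨ ⊕-comm (H x₁) (H x₀) ⟩
    H x₀ ⊕ H x₁                ∎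

  x₁-solution : H (x₁ ⊕ (x₀ ⊕ x₁)) ⊕ H x₁ ≡ H x₀ ⊕ H x₁
  x₁-solution = cong (λ w → H w ⊕ H x₁) (trans (cong (x₁ ⊕_) (⊕-comm x₀ x₁)) (x⊕[x⊕y]≡y x₁ x₀))

  x₂-solution : H (x₂ ⊕ (x₀ ⊕ x₁)) ⊕ H x₂ ≡ H x₀ ⊕ H x₁
  x₂-solution = begin
    H (x₂ ⊕ (x₀ ⊕ x₁)) ⊕ H x₂  ≡⟨ cong (λ w → H (x₂ ⊕ w) ⊕ H x₂) (sum≡𝟎⇒pairs x-sum≡𝟎) ⟩
    H (x₂ ⊕ (x₂ ⊕ x₃)) ⊕ H x₂  ≡⟨ cong (λ w → H w ⊕ H x₂) (x⊕[x⊕y]≡y x₂ x₃) ⟩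
    H x₃ ⊕ H x₂                ≡⟨ ⊕-comm (H x₃) (H x₂) ⟩
    H x₂ ⊕ H x₃                ≡⟨ sum≡𝟎⇒pairs H-sum≡𝟎 ⟨
    H x₀ ⊕ H x₁                ∎

-- One of y, z differs from x ⊕ a; with x it spans the flat {x, x ⊕ a, y, y ⊕ a}, on which H sums to b ⊕ b.
flat-sum≢𝟎⇒APN : ∀ {n} {H : V n → V n} → (∀ x → IsFlat x → Σ₄ (H ∘ x) ≢ 𝟎) → APN H
flat-sum≢𝟎⇒APN {H = H} flat-sum≢𝟎 a b a≢𝟎 x y z x≢y x≢z y≢z (x-solution , y-solution , z-solution) =
  case ≡-dec Bool._≟_ y (x ⊕ a) of λ where
    (no  y≢x⊕a) → no-two-solutions x≢y y≢x⊕a x-solution y-solution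
    (yes y≡x⊕a) → no-two-solutions x≢z (λ z≡x⊕a → y≢z (trans y≡x⊕a (sym z≡x⊕a))) x-solution z-solution
  where
  no-two-solutions : ∀ {p q} → p ≢ q → q ≢ p ⊕ a → IsSolution H a b p → IsSolution H a b q → ⊥
  no-two-solutions {p} {q} p≢q q≢p⊕a p-solution q-solution =
    flat-sum≢𝟎 (lookup (p ∷ p ⊕ a ∷ q ∷ q ⊕ a ∷ [])) (translates-flat a≢𝟎 p≢q q≢p⊕a)
      (pairs⇒sum≡𝟎 (trans (⊕-comm (H p) (H (p ⊕ a)))
        (trans p-solution (sym (trans (⊕-comm (H q) (H (q ⊕ a))) q-solution)))))

·-distribʳ-xor : ∀ {n} c d (v : V n) → (c xor d) · v ≡ c · v ⊕ d · v
·-distribʳ-xor c d []      = refl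
·-distribʳ-xor c d (x ∷ v) = cong₂ _∷_ (∧-distribʳ-xor x c d) (·-distribʳ-xor c d v)

lincomb-⊕ : ∀ {n k} (cs ds : Vec Bool k) (bs : Vec (V n) k) →
  lincomb (cs ⊕ ds) bs ≡ lincomb cs bs ⊕ lincomb ds bs
lincomb-⊕ []       []       []       = sym (⊕-self 𝟎)
lincomb-⊕ (c ∷ cs) (d ∷ ds) (b ∷ bs) = begin
  (c xor d) · b ⊕ lincomb (cs ⊕ ds) bs
    ≡⟨ cong₂ _⊕_ (·-distribʳ-xor c d b) (lincomb-⊕ cs ds bs) ⟩
  (c · b ⊕ d · b) ⊕ (lincomb cs bs ⊕ lincomb ds bs)
    ≡⟨ ⊕-interchange (c · b) (d · b) (lincomb cs bs) (lincomb ds bs) ⟩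
  (c · b ⊕ lincomb cs bs) ⊕ (d · b ⊕ lincomb ds bs) ∎

∈Span-⊕ : ∀ {n k} {x y : V n} {bs : Vec (V n) k} → x ∈Span bs → y ∈Span bs → (x ⊕ y) ∈Span bs
∈Span-⊕ {bs = bs} (cs , refl) (ds , refl) = cs ⊕ ds , lincomb-⊕ cs ds bs

module Cosets {n k m} (B : Vec (V n) k) (u : Fin m → V n)
    (disjoint : ∀ i j → i ≢ j → ¬ ((u i ⊕ u j) ∈Span B))
    (cover : ∀ x → Σ (Fin m) λ i → (x ⊕ u i) ∈Span B) where

  infix 4 _∼_
  _∼_ : V n → V n → Set
  x ∼ y = (x ⊕ y) ∈Span B

  ∼-sym : ∀ {x y} → x ∼ y → y ∼ x
  ∼-sym {x} {y} = subst (_∈Span B) (⊕-comm x y)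

  ∼-trans : ∀ {x y z} → x ∼ y → y ∼ z → x ∼ z
  ∼-trans {x} {y} {z} x∼y y∼z =
    subst (_∈Span B) (trans (⊕-assoc x y (y ⊕ z)) (cong (x ⊕_) (x⊕[x⊕y]≡y y z))) (∈Span-⊕ x∼y y∼z)

  coset : V n → Fin m
  coset x = proj₁ (cover x)

  ∼-coset : ∀ x → x ∼ u (coset x)
  ∼-coset x = proj₂ (cover x)

  coset-unique : ∀ {x i} → x ∼ u i → coset x ≡ i
  coset-unique {x} {i} x∼uᵢ with coset x ≟ i
  ... | yes same = same
  ... | no  different = contradiction (∼-trans (∼-sym (∼-coset x)) x∼uᵢ) (disjoint _ _ different)

  ≡coset⇒∼ : ∀ {x y} → coset x ≡ coset y → x ∼ y
  ≡coset⇒∼ {x} {y} same = ∼-trans (∼-coset x) (subst (λ i → u i ∼ y) (sym same) (∼-sym (∼-coset y)))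

  ∼⇒≡coset : ∀ {x y} → x ∼ y → coset x ≡ coset y
  ∼⇒≡coset {y = y} x∼y = coset-unique (∼-trans x∼y (∼-coset y))

  coset-pair : ∀ {p q r s} → p ⊕ q ≡ r ⊕ s → coset p ≡ coset q → coset r ≡ coset s
  coset-pair p⊕q≡r⊕s same = ∼⇒≡coset (subst (_∈Span B) p⊕q≡r⊕s (≡coset⇒∼ same))

  -- For m = 4 this unfolds to the condition ∀ i → ExactlyOne (λ j → x j ∈ Uᵢ) of the theorem.
  Transversal : (Fin m → V n) → Set
  Transversal x = ∀ i → Σ (Fin m) λ j → x j ∼ u i × (∀ j′ → x j′ ∼ u i → j′ ≡ j)

  transversal⇒injective : ∀ {x} → Transversal x → Injective _≡_ _≡_ (coset ∘ x)
  transversal⇒injective {x} T {j} {j′} same with T (coset (x j))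
  ... | _ , _ , unique =
    trans (unique j (∼-coset (x j))) (sym (unique j′ (subst (λ i → x j′ ∼ u i) (sym same) (∼-coset (x j′)))))

  injective⇒transversal : ∀ {x} → Injective _≡_ _≡_ (coset ∘ x) → Transversal x
  injective⇒transversal {x} injective i with injective⇒strictlySurjective injective i
  ... | j , cosetⱼ≡i =
    j , subst (λ i → x j ∼ u i) cosetⱼ≡i (∼-coset (x j)) ,
    λ j′ xⱼ′∼uᵢ → injective (trans (coset-unique xⱼ′∼uᵢ) (sym cosetⱼ≡i))

  collision⇒Σ₄≡𝟎 : ∀ (h : Fin m → V n) {x : Fin 4 → V n} {j k} → Σ₄ x ≡ 𝟎 → j < k →
    coset (x j) ≡ coset (x k) → Σ₄ (h ∘ coset ∘ x) ≡ 𝟎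
  collision⇒Σ₄≡𝟎 h {x} {j} {k} x-sum≡𝟎 j<k collide with l , l′ , split ← Σ₄-split j<k = begin
    Σ₄ (h ∘ coset ∘ x)
      ≡⟨ split (h ∘ coset ∘ x) ⟩
    (h (coset (x j)) ⊕ h (coset (x k))) ⊕ (h (coset (x l)) ⊕ h (coset (x l′)))
      ≡⟨ cong₂ _⊕_ (pair-vanishes collide) (pair-vanishes collide′) ⟩
    𝟎 ⊕ 𝟎
      ≡⟨ ⊕-self 𝟎 ⟩
    𝟎 ∎
    where
    collide′ : coset (x l) ≡ coset (x l′)
    collide′ = coset-pair (⊕≡𝟎⇒≡ (trans (sym (split x)) x-sum≡𝟎)) collide

    pair-vanishes : ∀ {i i′} → i ≡ i′ → h i ⊕ h i′ ≡ 𝟎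
    pair-vanishes refl = ⊕-self _

module Switching {n k} (F : V n → V n) (B : Vec (V n) k) (u : Fin 4 → V n)
    (disjoint : ∀ i j → i ≢ j → ¬ ((u i ⊕ u j) ∈Span B))
    (cover : ∀ x → Σ (Fin 4) λ i → (x ⊕ u i) ∈Span B)
    (a : Fin 4 → V n) (G : V n → V n)
    (G-def : ∀ i x → (x ⊕ u i) ∈Span B → G x ≡ F x ⊕ a i) where

  open Cosets B u disjoint cover public

  Σ₄-G : ∀ x → Σ₄ (G ∘ x) ≡ Σ₄ (F ∘ x) ⊕ Σ₄ (a ∘ coset ∘ x)
  Σ₄-G x = trans (Σ₄-cong λ j → G-def _ (x j) (∼-coset (x j))) (Σ₄-⊕ (F ∘ x) (a ∘ coset ∘ x))

  Σ₄-G-transversal : ∀ {x} → Transversal x → Σ₄ (G ∘ x) ≡ Σ₄ (F ∘ x) ⊕ Σ₄ a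
  Σ₄-G-transversal {x} T =
    trans (Σ₄-G x) (cong (Σ₄ (F ∘ x) ⊕_) (Σ₄-∘-injective a (transversal⇒injective T)))

  Σ₄-G-collision : ∀ {x j k} → Σ₄ x ≡ 𝟎 → j < k → coset (x j) ≡ coset (x k) → Σ₄ (G ∘ x) ≡ Σ₄ (F ∘ x)
  Σ₄-G-collision {x} x-sum≡𝟎 j<k collide = begin
    Σ₄ (G ∘ x)                          ≡⟨ Σ₄-G x ⟩
    Σ₄ (F ∘ x) ⊕ Σ₄ (a ∘ coset ∘ x)     ≡⟨ cong (Σ₄ (F ∘ x) ⊕_) (collision⇒Σ₄≡𝟎 a x-sum≡𝟎 j<k collide) ⟩
    Σ₄ (F ∘ x) ⊕ 𝟎                      ≡⟨ ⊕-identityʳ (Σ₄ (F ∘ x)) ⟩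
    Σ₄ (F ∘ x)                          ∎

theorem5 : (n : ℕ) (F : V n → V n) → APN F →
    (B : Vec (V n) (n ∸ 2)) → LinIndep B →
    (u : Fin 4 → V n) → u zero ≡ 𝟎 →
    (∀ (i j : Fin 4) → i ≢ j → ¬ ((u i ⊕ u j) ∈Span B)) →
    (∀ (x : V n) → Σ (Fin 4) λ i → (x ⊕ u i) ∈Span B) →
    (a : Fin 4 → V n) →
    (G : V n → V n) →
    (∀ (i : Fin 4) (x : V n) → (x ⊕ u i) ∈Span B → G x ≡ F x ⊕ a i) →
    APN G ⇔
      (∀ (x : Fin 4 → V n) →
        Affine2 (x zero) (x (suc zero)) (x (suc (suc zero))) (x (suc (suc (suc zero)))) →
        (∀ (i : Fin 4) → ExactlyOne (λ j → (x j ⊕ u i) ∈Span B)) →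
        F (x zero) ⊕ F (x (suc zero)) ⊕ F (x (suc (suc zero))) ⊕ F (x (suc (suc (suc zero))))
          ≢ a zero ⊕ a (suc zero) ⊕ a (suc (suc zero)) ⊕ a (suc (suc (suc zero))))
theorem5 n F F-APN B _ u _ disjoint cover a G G-def = mk⇔ G-APN⇒condition condition⇒G-APN
  where
  open Switching F B u disjoint cover a G G-def

  Condition : Set
  Condition = ∀ x → IsFlat x → Transversal x → Σ₄ (F ∘ x) ≢ Σ₄ a

  G-APN⇒condition : APN G → Condition
  G-APN⇒condition G-APN x flat T F-sum≡a-sum = APN⇒flat-sum≢𝟎 G-APN x flat (begin
    Σ₄ (G ∘ x)         ≡⟨ Σ₄-G-transversal T ⟩
    Σ₄ (F ∘ x) ⊕ Σ₄ a  ≡⟨ cong (_⊕ Σ₄ a) F-sum≡a-sum ⟩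
    Σ₄ a ⊕ Σ₄ a        ≡⟨ ⊕-self (Σ₄ a) ⟩
    𝟎                  ∎)

  condition⇒G-APN : Condition → APN G
  condition⇒G-APN condition = flat-sum≢𝟎⇒APN λ x flat G-sum≡𝟎 →
    case injective-or-collision (coset ∘ x) of λ where
      (inj₁ injective) →
        let T = injective⇒transversal injective
        in condition x flat T (⊕≡𝟎⇒≡ (trans (sym (Σ₄-G-transversal T)) G-sum≡𝟎))
      (inj₂ (j , k , j<k , collide)) →
        APN⇒flat-sum≢𝟎 F-APN x flat
          (trans (sym (Σ₄-G-collision (flat⇒Σ₄≡𝟎 {x = x} flat) j<k collide)) G-sum≡𝟎)
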